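{- Let $n\ge 1$ be an integer, let $A\subseteq\mathbb{Z}_5^n$ be sum-free, and let $H<\mathbb{Z}_5^n$ be a maximal proper subgroup. If there is an $H$-coset $C$ with $|A\cap C|>\frac12|C|$, then $A$ has non-empty intersection with at most three $H$-cosets.
   Context: $\mathbb{Z}_5^n$ denotes the elementary abelian $5$-group of rank $n$. A subset $S$ of an abelian group is sum-free if there are no $x,y,z\in S$ (not necessarily distinct) with $x+y=z$. -}

module Defs where

open import Data.Nat using (ℕ; zero; suc; _+_; _*_; _∸_; _<_)
open import Data.Nat.DivMod using (_mod_)
open import Data.Fin using (Fin; toℕ)
open import Data.Vec using (Vec; []; _∷_; replicate; zipWith; map)
open import Data.List using (List; [_]; concatMap; allFin; length; filter)
import Data.List as L
open import Data.Bool using (Bool; true; false; T?; _∧_)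
open import Data.Product using (∃; _×_; _,_)
open import Data.Sum using (_⊎_)
open import Relation.Binary.PropositionalEquality using (_≡_)

_+₅_ : Fin 5 → Fin 5 → Fin 5
a +₅ b = (toℕ a + toℕ b) mod 5

-₅_ : Fin 5 → Fin 5
-₅ a = (5 ∸ toℕ a) mod 5

V : ℕ → Set
V n = Vec (Fin 5) n

_⊕_ : ∀ {n} → V n → V n → V n
x ⊕ y = zipWith _+₅_ x y

⊖_ : ∀ {n} → V n → V n
⊖ x = map -₅_ x

𝟘 : ∀ {n} → V n
𝟘 {n} = replicate n Fin.zero

Subset : ℕ → Set
Subset n = V n → Bool

_∈_ : ∀ {n} → V n → Subset n → Set
x ∈ S = S x ≡ true

_∩_ : ∀ {n} → Subset n → Subset n → Subset n
(S ∩ T) x = S x ∧ T x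

elems : ∀ n → List (V n)
elems zero = [ [] ]
elems (suc n) = concatMap (λ a → L.map (a ∷_) (elems n)) (allFin 5)

∣_∣ : ∀ {n} → Subset n → ℕ
∣_∣ {n} S = length (filter (λ x → T? (S x)) (elems n))

SumFree : ∀ {n} → Subset n → Set
SumFree S = ∀ x y → x ∈ S → y ∈ S → S (x ⊕ y) ≡ false

record IsSubgroup {n} (H : Subset n) : Set where
  field
    has-zero : 𝟘 ∈ H
    ⊕-closed : ∀ x y → x ∈ H → y ∈ H → (x ⊕ y) ∈ H
    ⊖-closed : ∀ x → x ∈ H → (⊖ x) ∈ H

IsProper : ∀ {n} → Subset n → Set
IsProper H = ∃ λ x → H x ≡ false

_⊆_ : ∀ {n} → Subset n → Subset n → Set
S ⊆ T = ∀ x → x ∈ S → x ∈ T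

record IsMaximalProperSubgroup {n} (H : Subset n) : Set where
  field
    subgroup : IsSubgroup H
    proper   : IsProper H
    maximal  : ∀ K → IsSubgroup K → IsProper K → H ⊆ K → K ⊆ H

coset : ∀ {n} → Subset n → V n → Subset n
coset H g x = H (x ⊕ (⊖ g))

-- Let K = g + H with |A ∩ K| > |K|/2. If φ is a bijection of ℤ₅ⁿ with φ⁻¹(K) ⊆ K,
-- then A ∩ K and φ⁻¹(A ∩ K) are subsets of K of total size > |K|, so they meet:
-- some v ∈ A has φ v ∈ A. For x ∈ H take φ v = x + v, for x ∈ 2g + H take
-- φ v = x − v; either way x ∈ A would yield a solution of x + y = z in A, so A
-- avoids H and 2g + H. As A meets K, g ∉ H, so by maximality H + ⟨g⟩ is the whole
-- group: every element lies in some kg + H with k ∈ ℤ₅, and A lies in g + H,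
-- 3g + H and 4g + H.
module Submission where

open import Defs
open import Data.Nat using (ℕ; zero; suc; _+_; _*_; _≤_; _<_; z≤n; s≤s; z<s)
open import Data.Nat.Properties
  using ( +-0-commutativeMonoid; ≤-refl; +-mono-≤; +-identityʳ; +-cancelˡ-<; *-cancelˡ-<
        ; ≤-<-trans; module ≤-Reasoning)
open import Data.Nat.DivMod using (_mod_)
open import Data.Nat.ListAction using (sum)
open import Data.Fin using (Fin; zero; suc; toℕ)
open import Data.Fin.Patterns using (0F; 1F; 2F; 3F; 4F)
open import Data.Fin.Permutation using (Permutation′; permutation; _⟨$⟩ʳ_)
open import Data.Fin.Properties using (all?; any?; _≟_)
open import Data.Vec using (Vec; []; _∷_; zipWith; map)
open import Data.Vec.Properties
  using ( zipWith-assoc; zipWith-comm; zipWith-identityˡ; zipWith-identityʳ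
        ; zipWith-inverseˡ; zipWith-inverseʳ; zipWith-map₂
        ; map-cong; map-const; map-id; map-∘)
open import Data.List as List using (List; []; _∷_; length; filter; concatMap; tabulate; allFin)
open import Data.List.Properties using (filter-++; length-++; map-tabulate)
import Data.List.Properties as Listₚ
open import Data.Bool using (Bool; true; false; T?; _∧_)
open import Data.Bool.Properties using (∧-conicalˡ; ∧-conicalʳ; not-¬) renaming (_≟_ to _≟ᵇ_)
open import Data.Product using (∃; ∃₂; _×_; _,_; map₂)
open import Data.Sum using (_⊎_; inj₁; inj₂)
open import Function using (_∘_)
open import Level using (0ℓ)
open import Relation.Nullary using (¬_; Dec; does; yes; contradiction)
open import Relation.Nullary.Decidable using (True; toWitness; dec-true)
open import Relation.Binary.PropositionalEquality
  using (_≡_; refl; sym; trans; cong; cong₂; subst; isEquivalence; module ≡-Reasoning)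
open import Relation.Binary.Bundles using (Setoid)
open import Algebra.Bundles using (AbelianGroup)
open import Algebra.Structures using (IsAbelianGroup)
open import Algebra.Properties.CommutativeMonoid.Sum +-0-commutativeMonoid
  using (sum-syntax; sum-cong-≗; ∑-distrib-+; ∑-permute)
  renaming (sum to ∑)
import Algebra.Properties.AbelianGroup as AbelianGroupProperties
import Algebra.Properties.CommutativeSemigroup as CommutativeSemigroupProperties
import Relation.Binary.Reasoning.Setoid as SetoidReasoning

module AbelianGroupLemmas {a ℓ} (G : AbelianGroup a ℓ) where
  open AbelianGroup G
  open AbelianGroupProperties G
  open CommutativeSemigroupProperties commutativeSemigroup using (interchange)
  open SetoidReasoning setoid

  x∙[y-x]≈y : ∀ x y → x ∙ (y - x) ≈ y
  x∙[y-x]≈y x y = begin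
    x ∙ (y - x)   ≈⟨ assoc x y (x ⁻¹) ⟨
    x ∙ y ∙ x ⁻¹  ≈⟨ xyx⁻¹≈y x y ⟩
    y             ∎

  x-[x-y]≈y : ∀ x y → x - (x - y) ≈ y
  x-[x-y]≈y x y = begin
    x - (x - y)   ≈⟨ ∙-congˡ (⁻¹-anti-homo‿- x y) ⟩
    x ∙ (y - x)   ≈⟨ x∙[y-x]≈y x y ⟩
    y             ∎

  [x-y]∙[y-z]≈x-z : ∀ x y z → (x - y) ∙ (y - z) ≈ x - z
  [x-y]∙[y-z]≈x-z x y z = begin
    (x - y) ∙ (y - z)      ≈⟨ assoc x (y ⁻¹) (y - z) ⟩
    x ∙ (y ⁻¹ ∙ (y - z))   ≈⟨ ∙-congˡ (\\-leftDividesʳ y (z ⁻¹)) ⟩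
    x - z                  ∎

  x-ε≈x : ∀ x → x - ε ≈ x
  x-ε≈x x = begin
    x - ε   ≈⟨ ∙-congˡ ε⁻¹≈ε ⟩
    x ∙ ε   ≈⟨ identityʳ x ⟩
    x       ∎

  -‿interchange : ∀ x x′ y y′ → (x - x′) ∙ (y - y′) ≈ (x ∙ y) - (x′ ∙ y′)
  -‿interchange x x′ y y′ = begin
    (x - x′) ∙ (y - y′)        ≈⟨ interchange x (x′ ⁻¹) y (y′ ⁻¹) ⟩
    (x ∙ y) ∙ (x′ ⁻¹ ∙ y′ ⁻¹)  ≈⟨ ∙-congˡ (⁻¹-∙-comm x′ y′) ⟩
    (x ∙ y) - (x′ ∙ y′)        ∎

-- The implicit argument normalises to ⊤ exactly when the identity holds at all
-- points, so each law of ℤ₅ below is checked by evaluation.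
exhaustive₁ : {f g : Fin 5 → Fin 5} {_ : True (all? λ a → f a ≟ g a)} → ∀ a → f a ≡ g a
exhaustive₁ {_} {_} {t} = toWitness t

exhaustive₂ : {f g : Fin 5 → Fin 5 → Fin 5} {_ : True (all? λ a → all? λ b → f a b ≟ g a b)} →
              ∀ a b → f a b ≡ g a b
exhaustive₂ {_} {_} {t} = toWitness t

exhaustive₃ : {f g : Fin 5 → Fin 5 → Fin 5 → Fin 5}
              {_ : True (all? λ a → all? λ b → all? λ c → f a b c ≟ g a b c)} →
              ∀ a b c → f a b c ≡ g a b c
exhaustive₃ {_} {_} {t} = toWitness t

_*₅_ : Fin 5 → Fin 5 → Fin 5
a *₅ b = (toℕ a * toℕ b) mod 5

+₅-assoc : ∀ a b c → (a +₅ b) +₅ c ≡ a +₅ (b +₅ c)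
+₅-assoc = exhaustive₃

+₅-comm : ∀ a b → a +₅ b ≡ b +₅ a
+₅-comm = exhaustive₂

+₅-identityˡ : ∀ a → 0F +₅ a ≡ a
+₅-identityˡ = exhaustive₁

+₅-identityʳ : ∀ a → a +₅ 0F ≡ a
+₅-identityʳ = exhaustive₁

-₅-inverseˡ : ∀ a → (-₅ a) +₅ a ≡ 0F
-₅-inverseˡ = exhaustive₁

-₅-inverseʳ : ∀ a → a +₅ (-₅ a) ≡ 0F
-₅-inverseʳ = exhaustive₁

+₅-cancelˡ : ∀ c a → c +₅ ((-₅ c) +₅ a) ≡ a
+₅-cancelˡ = exhaustive₂

-₅-cancelˡ : ∀ c a → (-₅ c) +₅ (c +₅ a) ≡ a
-₅-cancelˡ = exhaustive₂

-₅-involutiveʳ : ∀ c a → c +₅ (-₅ (c +₅ (-₅ a))) ≡ a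
-₅-involutiveʳ = exhaustive₂

*₅-zeroˡ : ∀ a → 0F *₅ a ≡ 0F
*₅-zeroˡ = exhaustive₁

*₅-identityˡ : ∀ a → 1F *₅ a ≡ a
*₅-identityˡ = exhaustive₁

*₅-distribʳ-+₅ : ∀ a i j → (i +₅ j) *₅ a ≡ (i *₅ a) +₅ (j *₅ a)
*₅-distribʳ-+₅ = exhaustive₃

-₅-*₅ : ∀ i a → (-₅ i) *₅ a ≡ -₅ (i *₅ a)
-₅-*₅ = exhaustive₂

translation : Fin 5 → Permutation′ 5
translation c = permutation (c +₅_) ((-₅ c) +₅_) (+₅-cancelˡ c) (-₅-cancelˡ c)

reflection : Fin 5 → Permutation′ 5
reflection c = permutation (λ a → c +₅ (-₅ a)) (λ a → c +₅ (-₅ a))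
                           (-₅-involutiveʳ c) (-₅-involutiveʳ c)

⊕-isAbelianGroup : ∀ {n} → IsAbelianGroup _≡_ (_⊕_ {n}) 𝟘 ⊖_
⊕-isAbelianGroup = record
  { isGroup = record
    { isMonoid = record
      { isSemigroup = record
        { isMagma = record { isEquivalence = isEquivalence ; ∙-cong = cong₂ _⊕_ }
        ; assoc   = zipWith-assoc +₅-assoc
        }
      ; identity = zipWith-identityˡ +₅-identityˡ , zipWith-identityʳ +₅-identityʳ
      }
    ; inverse = zipWith-inverseˡ -₅-inverseˡ , zipWith-inverseʳ -₅-inverseʳ
    ; ⁻¹-cong = cong ⊖_
    }
  ; comm = zipWith-comm +₅-comm
  }

⊕-abelianGroup : ℕ → AbelianGroup 0ℓ 0ℓ
⊕-abelianGroup n = record { isAbelianGroup = ⊕-isAbelianGroup {n} }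

infix 25 _·_
_·_ : ∀ {n} → Fin 5 → V n → V n
k · x = map (k *₅_) x

·-zeroˡ : ∀ {n} (x : V n) → 0F · x ≡ 𝟘
·-zeroˡ x = trans (map-cong *₅-zeroˡ x) (map-const x 0F)

·-identityˡ : ∀ {n} (x : V n) → 1F · x ≡ x
·-identityˡ x = trans (map-cong *₅-identityˡ x) (map-id x)

·-distribʳ-+₅ : ∀ {n} i j (x : V n) → (i +₅ j) · x ≡ (i · x) ⊕ (j · x)
·-distribʳ-+₅ i j []      = refl
·-distribʳ-+₅ i j (a ∷ x) = cong₂ _∷_ (*₅-distribʳ-+₅ a i j) (·-distribʳ-+₅ i j x)

2·x≡x⊕x : ∀ {n} (x : V n) → 2F · x ≡ x ⊕ x
2·x≡x⊕x x = trans (·-distribʳ-+₅ 1F 1F x) (cong₂ _⊕_ (·-identityˡ x) (·-identityˡ x))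

-₅-· : ∀ {n} i (x : V n) → (-₅ i) · x ≡ ⊖ (i · x)
-₅-· i x = trans (map-cong (-₅-*₅ i) x) (map-∘ -₅_ (i *₅_) x)

∑-mono-≤ : ∀ {k} {f g : Fin k → ℕ} → (∀ i → f i ≤ g i) → ∑ f ≤ ∑ g
∑-mono-≤ {zero}  _   = z≤n
∑-mono-≤ {suc k} f≤g = +-mono-≤ (f≤g zero) (∑-mono-≤ (f≤g ∘ suc))

∑-positive : ∀ {k} (f : Fin k → ℕ) → 0 < ∑ f → ∃ λ i → 0 < f i
∑-positive {zero}  f ()
∑-positive {suc k} f 0<∑ with f zero in eq
... | suc _ = zero , subst (0 <_) (sym eq) z<s
... | zero with i , 0<fi ← ∑-positive (f ∘ suc) 0<∑ = suc i , 0<fi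

sum-tabulate : ∀ {k} (h : Fin k → ℕ) → sum (tabulate h) ≡ ∑ h
sum-tabulate {zero}  h = refl
sum-tabulate {suc k} h = cong (h zero +_) (sum-tabulate (h ∘ suc))

module _ {m : ℕ} where

  ∑ᵛ : ∀ {n} → (Vec (Fin m) n → ℕ) → ℕ
  ∑ᵛ {zero}  f = f []
  ∑ᵛ {suc n} f = ∑[ a < m ] ∑ᵛ (f ∘ (a ∷_))

  ∑ᵛ-cong : ∀ {n} {f g : Vec (Fin m) n → ℕ} → (∀ v → f v ≡ g v) → ∑ᵛ f ≡ ∑ᵛ g
  ∑ᵛ-cong {zero}  f≗g = f≗g []
  ∑ᵛ-cong {suc n} f≗g = sum-cong-≗ λ a → ∑ᵛ-cong (f≗g ∘ (a ∷_))

  ∑ᵛ-distrib-+ : ∀ {n} (f g : Vec (Fin m) n → ℕ) → ∑ᵛ (λ v → f v + g v) ≡ ∑ᵛ f + ∑ᵛ g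
  ∑ᵛ-distrib-+ {zero}  f g = refl
  ∑ᵛ-distrib-+ {suc n} f g = trans
    (sum-cong-≗ λ a → ∑ᵛ-distrib-+ (f ∘ (a ∷_)) (g ∘ (a ∷_)))
    (∑-distrib-+ (λ a → ∑ᵛ (f ∘ (a ∷_))) (λ a → ∑ᵛ (g ∘ (a ∷_))))

  ∑ᵛ-mono-≤ : ∀ {n} {f g : Vec (Fin m) n → ℕ} → (∀ v → f v ≤ g v) → ∑ᵛ f ≤ ∑ᵛ g
  ∑ᵛ-mono-≤ {zero}  f≤g = f≤g []
  ∑ᵛ-mono-≤ {suc n} f≤g = ∑-mono-≤ λ a → ∑ᵛ-mono-≤ (f≤g ∘ (a ∷_))

  ∑ᵛ-positive : ∀ {n} (f : Vec (Fin m) n → ℕ) → 0 < ∑ᵛ f → ∃ λ v → 0 < f v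
  ∑ᵛ-positive {zero}  f 0<f = [] , 0<f
  ∑ᵛ-positive {suc n} f 0<∑
    with a , 0<∑a ← ∑-positive _ 0<∑
    with v , 0<fv ← ∑ᵛ-positive (f ∘ (a ∷_)) 0<∑a = a ∷ v , 0<fv

  ∑ᵛ-permute : ∀ {n} {C : Set} (π : C → Permutation′ m) (cs : Vec C n)
               (f : Vec (Fin m) n → ℕ) →
               ∑ᵛ (λ v → f (zipWith (λ c → π c ⟨$⟩ʳ_) cs v)) ≡ ∑ᵛ f
  ∑ᵛ-permute π []       f = refl
  ∑ᵛ-permute π (c ∷ cs) f = trans
    (sum-cong-≗ λ a → ∑ᵛ-permute π cs (f ∘ (π c ⟨$⟩ʳ a ∷_)))
    (sym (∑-permute (λ b → ∑ᵛ (f ∘ (b ∷_))) (π c)))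

𝟙 : Bool → ℕ
𝟙 true  = 1
𝟙 false = 0

count : ∀ {n} → Subset n → ℕ
count S = ∑ᵛ (𝟙 ∘ S)

length-filter-concatMap : ∀ {A B : Set} (p : B → Bool) (g : A → List B) xs →
  length (filter (T? ∘ p) (concatMap g xs))
    ≡ sum (List.map (λ x → length (filter (T? ∘ p) (g x))) xs)
length-filter-concatMap p g []       = refl
length-filter-concatMap p g (x ∷ xs) = begin
  length (filter (T? ∘ p) (g x List.++ concatMap g xs))
    ≡⟨ cong length (filter-++ (T? ∘ p) (g x) _) ⟩
  length (filter (T? ∘ p) (g x) List.++ filter (T? ∘ p) (concatMap g xs))
    ≡⟨ length-++ (filter (T? ∘ p) (g x)) ⟩
  length (filter (T? ∘ p) (g x)) + length (filter (T? ∘ p) (concatMap g xs))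
    ≡⟨ cong (length (filter (T? ∘ p) (g x)) +_) (length-filter-concatMap p g xs) ⟩
  length (filter (T? ∘ p) (g x)) + sum (List.map (λ x → length (filter (T? ∘ p) (g x))) xs)
    ∎
  where open ≡-Reasoning

length-filter-map : ∀ {A B : Set} (p : B → Bool) (f : A → B) xs →
  length (filter (T? ∘ p) (List.map f xs)) ≡ length (filter (T? ∘ p ∘ f) xs)
length-filter-map p f []       = refl
length-filter-map p f (x ∷ xs) with p (f x)
... | true  = cong suc (length-filter-map p f xs)
... | false = length-filter-map p f xs

∣∣≡count : ∀ {n} (S : Subset n) → ∣ S ∣ ≡ count S
∣∣≡count {zero} S with S []
... | true  = refl
... | false = refl
∣∣≡count {suc n} S = begin
  ∣ S ∣
    ≡⟨ length-filter-concatMap S (λ a → List.map (a ∷_) (elems n)) (allFin 5) ⟩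
  sum (List.map (λ a → length (filter (T? ∘ S) (List.map (a ∷_) (elems n)))) (allFin 5))
    ≡⟨ cong sum (Listₚ.map-cong
         (λ a → trans (length-filter-map S (a ∷_) (elems n)) (∣∣≡count (S ∘ (a ∷_)))) (allFin 5)) ⟩
  sum (List.map (λ a → count (S ∘ (a ∷_))) (allFin 5))
    ≡⟨ cong sum (map-tabulate (λ a → a) (λ a → count (S ∘ (a ∷_)))) ⟩
  sum (tabulate (λ a → count (S ∘ (a ∷_))))
    ≡⟨ sum-tabulate (λ a → count (S ∘ (a ∷_))) ⟩
  count S
    ∎
  where open ≡-Reasoning

𝟙-∩ : ∀ s t c → (s ≡ true → c ≡ true) → (t ≡ true → c ≡ true) →
      𝟙 s + 𝟙 t ≤ 𝟙 c + 𝟙 (s ∧ t)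
𝟙-∩ true  true  c s⇒c t⇒c rewrite s⇒c refl = ≤-refl
𝟙-∩ true  false c s⇒c t⇒c rewrite s⇒c refl = s≤s z≤n
𝟙-∩ false true  c s⇒c t⇒c rewrite t⇒c refl = s≤s z≤n
𝟙-∩ false false c s⇒c t⇒c = z≤n

count-∩ : ∀ {n} {S T C : Subset n} → S ⊆ C → T ⊆ C →
          count S + count T ≤ count C + count (S ∩ T)
count-∩ {S = S} {T} {C} S⊆C T⊆C = begin
  count S + count T                    ≡⟨ ∑ᵛ-distrib-+ (𝟙 ∘ S) (𝟙 ∘ T) ⟨
  ∑ᵛ (λ v → 𝟙 (S v) + 𝟙 (T v))         ≤⟨ ∑ᵛ-mono-≤ (λ v → 𝟙-∩ (S v) (T v) (C v) (S⊆C v) (T⊆C v)) ⟩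
  ∑ᵛ (λ v → 𝟙 (C v) + 𝟙 (S v ∧ T v))   ≡⟨ ∑ᵛ-distrib-+ (𝟙 ∘ C) (𝟙 ∘ (S ∩ T)) ⟩
  count C + count (S ∩ T)              ∎
  where open ≤-Reasoning

count-positive : ∀ {n} (S : Subset n) → 0 < count S → ∃ λ v → v ∈ S
count-positive S 0<∣S∣
  with v , 0<𝟙 ← ∑ᵛ-positive (𝟙 ∘ S) 0<∣S∣
  with S v in v∈S
... | true = v , v∈S

⊆-overlap : ∀ {n} {S T C : Subset n} → S ⊆ C → T ⊆ C → count C < count S + count T →
            ∃ λ v → v ∈ S × v ∈ T
⊆-overlap {S = S} {T} {C} S⊆C T⊆C C<S+T =
  map₂ (λ {v} v∈S∩T → ∧-conicalˡ (S v) (T v) v∈S∩T , ∧-conicalʳ (S v) (T v) v∈S∩T)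
       (count-positive (S ∩ T) 0<∣S∩T∣)
  where
  open ≤-Reasoning
  0<∣S∩T∣ : 0 < count (S ∩ T)
  0<∣S∩T∣ = +-cancelˡ-< (count C) 0 (count (S ∩ T)) (begin-strict
    count C + 0               ≡⟨ +-identityʳ (count C) ⟩
    count C                   <⟨ C<S+T ⟩
    count S + count T         ≤⟨ count-∩ S⊆C T⊆C ⟩
    count C + count (S ∩ T)   ∎)

count-⊕ : ∀ {n} (S : Subset n) x → count (λ v → S (x ⊕ v)) ≡ count S
count-⊕ S x = ∑ᵛ-permute translation x (𝟙 ∘ S)

count-⊖ : ∀ {n} (S : Subset n) x → count (λ v → S (x ⊕ (⊖ v))) ≡ count S
count-⊖ S x = trans
  (∑ᵛ-cong λ v → cong (𝟙 ∘ S) (zipWith-map₂ _+₅_ -₅_ x v))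
  (∑ᵛ-permute reflection x (𝟙 ∘ S))

infix 4 _∼[_]_
_∼[_]_ : ∀ {n} → V n → Subset n → V n → Set
x ∼[ H ] y = x ∈ coset H y

module ModSubgroup {n} {H : Subset n} (H-subgroup : IsSubgroup H) where
  open IsSubgroup H-subgroup
  open AbelianGroup (⊕-abelianGroup n) using (identityˡ; inverseʳ)
  open AbelianGroupProperties (⊕-abelianGroup n)
    using (⁻¹-anti-homo‿-; ⁻¹-∙-comm; \\-leftDividesʳ; //-rightDividesʳ)
  open AbelianGroupLemmas (⊕-abelianGroup n) using ([x-y]∙[y-z]≈x-z; x-ε≈x; -‿interchange; x-[x-y]≈y)

  _∼_ : V n → V n → Set
  x ∼ y = x ∼[ H ] y

  ∼-refl : ∀ {x} → x ∼ x
  ∼-refl {x} = subst (_∈ H) (sym (inverseʳ x)) has-zero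

  ∼-sym : ∀ {x y} → x ∼ y → y ∼ x
  ∼-sym {x} {y} x∼y = subst (_∈ H) (⁻¹-anti-homo‿- x y) (⊖-closed _ x∼y)

  ∼-trans : ∀ {x y z} → x ∼ y → y ∼ z → x ∼ z
  ∼-trans {x} {y} {z} x∼y y∼z = subst (_∈ H) ([x-y]∙[y-z]≈x-z x y z) (⊕-closed _ _ x∼y y∼z)

  ∼-setoid : Setoid 0ℓ 0ℓ
  ∼-setoid = record
    { Carrier       = V n
    ; _≈_           = _∼_
    ; isEquivalence = record { refl = ∼-refl ; sym = ∼-sym ; trans = ∼-trans }
    }

  ≡⇒∼ : ∀ {x y} → x ≡ y → x ∼ y
  ≡⇒∼ refl = ∼-refl

  ⊕-cong : ∀ {x x′ y y′} → x ∼ x′ → y ∼ y′ → (x ⊕ y) ∼ (x′ ⊕ y′)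
  ⊕-cong {x} {x′} {y} {y′} x∼x′ y∼y′ = subst (_∈ H) (-‿interchange x x′ y y′) (⊕-closed _ _ x∼x′ y∼y′)

  ⊖-cong : ∀ {x y} → x ∼ y → (⊖ x) ∼ (⊖ y)
  ⊖-cong {x} {y} x∼y = subst (_∈ H) (sym (⁻¹-∙-comm x (⊖ y))) (⊖-closed _ x∼y)

  ∈⇒∼𝟘 : ∀ {x} → x ∈ H → x ∼ 𝟘
  ∈⇒∼𝟘 {x} = subst (_∈ H) (sym (x-ε≈x x))

  ∼𝟘⇒∈ : ∀ {x} → x ∼ 𝟘 → x ∈ H
  ∼𝟘⇒∈ {x} = subst (_∈ H) (x-ε≈x x)

  open SetoidReasoning ∼-setoid

  ∼-cancelˡ : ∀ {x v g} → x ∈ H → (x ⊕ v) ∼ g → v ∼ g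
  ∼-cancelˡ {x} {v} {g} x∈H x+v∼g = begin
    v                  ≡⟨ \\-leftDividesʳ x v ⟨
    (⊖ x) ⊕ (x ⊕ v)    ≈⟨ ⊕-cong (∈⇒∼𝟘 (⊖-closed x x∈H)) x+v∼g ⟩
    𝟘 ⊕ g              ≡⟨ identityˡ g ⟩
    g                  ∎

  ∼-reflect : ∀ {x v g} → x ∼ (g ⊕ g) → (x ⊕ (⊖ v)) ∼ g → v ∼ g
  ∼-reflect {x} {v} {g} x∼2g x-v∼g = begin
    v                      ≡⟨ x-[x-y]≈y x v ⟨
    x ⊕ (⊖ (x ⊕ (⊖ v)))    ≈⟨ ⊕-cong x∼2g (⊖-cong x-v∼g) ⟩
    (g ⊕ g) ⊕ (⊖ g)        ≡⟨ //-rightDividesʳ g g ⟩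
    g                      ∎

∼-multiple? : ∀ {n} (H : Subset n) (g x : V n) → Dec (∃ λ k → x ∼[ H ] k · g)
∼-multiple? H g x = any? λ k → H (x ⊕ (⊖ (k · g))) ≟ᵇ true

infix 25 _+⟨_⟩
_+⟨_⟩ : ∀ {n} → Subset n → V n → Subset n
(H +⟨ g ⟩) x = does (∼-multiple? H g x)

module _ {n} {H : Subset n} (H-subgroup : IsSubgroup H) {g : V n} where
  open ModSubgroup H-subgroup

  ∈-+⟨⟩⁺ : ∀ {x} k → x ∼ k · g → x ∈ H +⟨ g ⟩
  ∈-+⟨⟩⁺ {x} k x∼kg = dec-true (∼-multiple? H g x) (k , x∼kg)

  ∈-+⟨⟩⁻ : ∀ {x} → x ∈ H +⟨ g ⟩ → ∃ λ k → x ∼ k · g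
  ∈-+⟨⟩⁻ {x} = witness (∼-multiple? H g x)
    where
    witness : ∀ {P : Set} (P? : Dec P) → does P? ≡ true → P
    witness (yes p) _ = p

  +⟨⟩-isSubgroup : IsSubgroup (H +⟨ g ⟩)
  +⟨⟩-isSubgroup = record
    { has-zero = ∈-+⟨⟩⁺ 0F (≡⇒∼ (sym (·-zeroˡ g)))
    ; ⊕-closed = λ x y x∈ y∈ → closed (∈-+⟨⟩⁻ x∈) (∈-+⟨⟩⁻ y∈)
    ; ⊖-closed = λ x x∈ → inverse (∈-+⟨⟩⁻ x∈)
    }
    where
    closed : ∀ {x y} → ∃ (λ i → x ∼ i · g) → ∃ (λ j → y ∼ j · g) → (x ⊕ y) ∈ H +⟨ g ⟩
    closed (i , x∼ig) (j , y∼jg) =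
      ∈-+⟨⟩⁺ (i +₅ j) (∼-trans (⊕-cong x∼ig y∼jg) (≡⇒∼ (sym (·-distribʳ-+₅ i j g))))
    inverse : ∀ {x} → ∃ (λ i → x ∼ i · g) → (⊖ x) ∈ H +⟨ g ⟩
    inverse (i , x∼ig) = ∈-+⟨⟩⁺ (-₅ i) (∼-trans (⊖-cong x∼ig) (≡⇒∼ (sym (-₅-· i g))))

  ⊆-+⟨⟩ : H ⊆ H +⟨ g ⟩
  ⊆-+⟨⟩ x x∈H = ∈-+⟨⟩⁺ 0F (∼-trans (∈⇒∼𝟘 x∈H) (≡⇒∼ (sym (·-zeroˡ g))))

  g∈+⟨g⟩ : g ∈ H +⟨ g ⟩
  g∈+⟨g⟩ = ∈-+⟨⟩⁺ 1F (≡⇒∼ (sym (·-identityˡ g)))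

module _ {n} {H : Subset n} (H-maximal : IsMaximalProperSubgroup H) where
  open IsMaximalProperSubgroup H-maximal

  maximal⇒∼-multiple : ∀ {g} → ¬ g ∈ H → ∀ x → ∃ λ k → x ∼[ H ] k · g
  maximal⇒∼-multiple {g} g∉H x with (H +⟨ g ⟩) x in x∈
  ... | true  = ∈-+⟨⟩⁻ subgroup x∈
  ... | false = contradiction
    (maximal (H +⟨ g ⟩) (+⟨⟩-isSubgroup subgroup) (x , x∈) (⊆-+⟨⟩ subgroup) g (g∈+⟨g⟩ subgroup))
    g∉H

module DenseCoset {n} {A H : Subset n} (A-sumFree : SumFree A) (H-subgroup : IsSubgroup H)
                  {g : V n} (dense : ∣ coset H g ∣ < 2 * ∣ A ∩ coset H g ∣) where
  open ModSubgroup H-subgroup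
  open AbelianGroupLemmas (⊕-abelianGroup n) using (x∙[y-x]≈y)

  private
    K S : Subset n
    K = coset H g
    S = A ∩ K

  sum-free : ∀ x y → x ∈ A → y ∈ A → ¬ (x ⊕ y) ∈ A
  sum-free x y x∈A y∈A = not-¬ (A-sumFree x y x∈A y∈A)

  meets-preimage : (φ : V n → V n) → (∀ P → count (P ∘ φ) ≡ count P) → (∀ v → φ v ∼ g → v ∼ g) →
                   ∃ λ v → v ∈ A × φ v ∈ A
  meets-preimage φ φ-preserves φ⁻¹K⊆K =
    map₂ (λ {v} (v∈S , φv∈S) → ∧-conicalˡ (A v) (K v) v∈S , ∧-conicalˡ (A (φ v)) (K (φ v)) φv∈S)
         (⊆-overlap (λ v → ∧-conicalʳ (A v) (K v))
                    (λ v φv∈S → φ⁻¹K⊆K v (∧-conicalʳ (A (φ v)) (K (φ v)) φv∈S))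
                    K<S+S∘φ)
    where
    open ≤-Reasoning
    K<S+S∘φ : count K < count S + count (S ∘ φ)
    K<S+S∘φ = begin-strict
      count K                   ≡⟨ ∣∣≡count K ⟨
      ∣ K ∣                     <⟨ dense ⟩
      2 * ∣ S ∣                 ≡⟨ cong (2 *_) (∣∣≡count S) ⟩
      count S + (count S + 0)   ≡⟨ cong (count S +_) (trans (+-identityʳ (count S)) (sym (φ-preserves S))) ⟩
      count S + count (S ∘ φ)   ∎

  ∈A⇒∉H : ∀ {x} → x ∈ A → ¬ x ∈ H
  ∈A⇒∉H {x} x∈A x∈H =
    let v , v∈A , x+v∈A = meets-preimage (x ⊕_) (λ P → count-⊕ P x) (λ v → ∼-cancelˡ x∈H)
    in sum-free x v x∈A v∈A x+v∈A

  ∈A⇒≁0g : ∀ {x} → x ∈ A → ¬ x ∼ 0F · g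
  ∈A⇒≁0g {x} x∈A x∼0g = ∈A⇒∉H x∈A (∼𝟘⇒∈ (begin
    x        ≈⟨ x∼0g ⟩
    0F · g   ≡⟨ ·-zeroˡ g ⟩
    𝟘        ∎))
    where open SetoidReasoning ∼-setoid

  ∈A⇒≁2g : ∀ {x} → x ∈ A → ¬ x ∼ 2F · g
  ∈A⇒≁2g {x} x∈A x∼2g =
    let v , v∈A , x-v∈A = meets-preimage (λ v → x ⊕ (⊖ v)) (λ P → count-⊖ P x)
                                         (λ v → ∼-reflect (∼-trans x∼2g (≡⇒∼ (2·x≡x⊕x g))))
    in sum-free v (x ⊕ (⊖ v)) v∈A x-v∈A (subst (_∈ A) (sym (x∙[y-x]≈y v x)) x∈A)

  A∩K-nonempty : ∃ λ a → a ∈ S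
  A∩K-nonempty = count-positive S
    (*-cancelˡ-< 2 0 (count S) (subst (λ s → 0 < 2 * s) (∣∣≡count S) (≤-<-trans z≤n dense)))

  g∉H : ¬ g ∈ H
  g∉H g∈H =
    let a , a∈S = A∩K-nonempty
    in ∈A⇒∉H (∧-conicalˡ (A a) (K a) a∈S) (∼𝟘⇒∈ (begin
      a   ≈⟨ ∧-conicalʳ (A a) (K a) a∈S ⟩
      g   ≈⟨ ∈⇒∼𝟘 g∈H ⟩
      𝟘   ∎))
    where open SetoidReasoning ∼-setoid

  ∈A⇒∼1g⊎3g⊎4g : ∀ {x} → x ∈ A → ∃ (λ k → x ∼ k · g) → x ∼ 1F · g ⊎ x ∼ 3F · g ⊎ x ∼ 4F · g
  ∈A⇒∼1g⊎3g⊎4g x∈A (0F , x∼0g) = contradiction x∼0g (∈A⇒≁0g x∈A)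
  ∈A⇒∼1g⊎3g⊎4g x∈A (1F , x∼1g) = inj₁ x∼1g
  ∈A⇒∼1g⊎3g⊎4g x∈A (2F , x∼2g) = contradiction x∼2g (∈A⇒≁2g x∈A)
  ∈A⇒∼1g⊎3g⊎4g x∈A (3F , x∼3g) = inj₂ (inj₁ x∼3g)
  ∈A⇒∼1g⊎3g⊎4g x∈A (4F , x∼4g) = inj₂ (inj₂ x∼4g)

proposition2 : (n : ℕ) → 1 ≤ n → (A H : Subset n) → SumFree A →
    IsMaximalProperSubgroup H →
    (∃ λ g → ∣ coset H g ∣ < 2 * ∣ A ∩ coset H g ∣) →
    ∃₂ λ g₁ g₂ → ∃ λ g₃ → ∀ x → x ∈ A →
      (x ∈ coset H g₁ ⊎ x ∈ coset H g₂ ⊎ x ∈ coset H g₃)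
proposition2 n _ A H A-sumFree H-maximal (g , dense) =
  1F · g , 3F · g , 4F · g , λ x x∈A → ∈A⇒∼1g⊎3g⊎4g x∈A (maximal⇒∼-multiple H-maximal g∉H x)
  where
  open IsMaximalProperSubgroup H-maximal using (subgroup)
  open DenseCoset A-sumFree subgroup dense
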